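{- Let $G$ be a finite simple graph on $n$ vertices. For every $r\ge n$, if $B$ is an optimal AON $r$-fold PSD forcing set for $G$, then $a(B)=a_\star^+(G)$.
   Context: For $r\in\mathbb{N}$, the $r$-blowup $G^{(r)}$ is obtained by replacing each vertex $u$ of $G$ by an independent set $R_u$ of $r$ vertices (a cluster) and each edge $uw$ by all edges between $R_u$ and $R_w$. $r$-fold PSD forcing game: an initial set $B\subseteq V(G^{(r)})$ is blue, the rest white. A forcing process is a sequence of steps. In an ordinary step, with $B_t$ the current blue set and $W_1,\dots,W_h$ the vertex sets of the connected components of $G^{(r)}-B_t$, a vertex $u\in B_t$ with $|N(u)\cap W_i|\le r$ for some $i$ colors all of $N(u)\cap W_i$ blue. Forcing processes may also use backforcing steps: if a vertex of a cluster $R_u$ that is not entirely blue has just performed a force, then at the next step all vertices of $R_u$ may be colored blue. $B$ is an $r$-fold PSD forcing set if some forcing process makes all of $G^{(r)}$ blue; $Z_{(r)}^+(G)$ is the minimum cardinality of such a set. A cluster is forced at a step if some of its vertices turn from white to blue at that step. Relative to a coloring, a cluster is an All cluster (all vertices blue), a One cluster (exactly one vertex blue) or a None cluster (all white). An AON $r$-fold PSD forcing set is an $r$-fold PSD forcing set $B$ for which every cluster of $G^{(r)}$ colored with $B$ is an All, One or None cluster; $a(B)$ and $\ell(B)$ denote its numbers of All and One clusters. An optimal AON $r$-fold PSD forcing set is an AON $r$-fold PSD forcing set of cardinality $Z_{(r)}^+(G)$ for which there is a forcing process starting from it in which exactly one cluster is forced at each step. For $G$ with $n$ vertices, optimal AON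 $n$-fold PSD forcing sets exist and all have the same number of All clusters; this number is denoted $a_\star^+(G)$. -}

module Defs where

open import Data.Nat using (ℕ; zero; suc; _+_; _≤_)
open import Data.Fin using (Fin; zero; suc)
open import Data.Bool using (Bool; true; false; if_then_else_; _∧_)
open import Data.Product using (Σ; _×_; _,_; ∃; proj₁)
open import Data.Sum using (_⊎_)
open import Data.Unit using (⊤)
open import Data.Maybe using (Maybe; just; nothing)
open import Data.List using (List; length)
open import Data.List.Membership.Propositional using (_∈_)
open import Relation.Binary.PropositionalEquality using (_≡_)
open import Relation.Nullary using (¬_)

record Graph (n : ℕ) : Set where
  field
    adj     : Fin n → Fin n → Bool
    symm    : ∀ u w → adj u w ≡ adj w u
    irrefl  : ∀ u → adj u u ≡ false
open Graph public

sumFin : ∀ {m} → (Fin m → ℕ) → ℕ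
sumFin {zero}  f = 0
sumFin {suc m} f = f zero + sumFin (λ i → f (suc i))

countFin : ∀ {m} → (Fin m → Bool) → ℕ
countFin p = sumFin (λ i → if p i then 1 else 0)

allFin? : ∀ {m} → (Fin m → Bool) → Bool
allFin? {zero}  p = true
allFin? {suc m} p = p zero ∧ allFin? (λ i → p (suc i))

-- The r-blowup G^(r): vertex (u , i) is the i-th vertex of cluster R_u.

V : ℕ → ℕ → Set
V n r = Fin n × Fin r

cluster : ∀ {n r} → V n r → Fin n
cluster = proj₁

AdjB : ∀ {n} → Graph n → (r : ℕ) → V n r → V n r → Set
AdjB G r (u , _) (w , _) = adj G u w ≡ true

Col : ℕ → ℕ → Set
Col n r = Fin n → Fin r → Bool

Blue : ∀ {n r} → Col n r → V n r → Set
Blue B (u , i) = B u i ≡ true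

White : ∀ {n r} → Col n r → V n r → Set
White B (u , i) = B u i ≡ false

size : ∀ {n r} → Col n r → ℕ
size B = sumFin (λ u → countFin (B u))

AllBlueCluster : ∀ {n r} → Col n r → Fin n → Set
AllBlueCluster B u = ∀ i → B u i ≡ true

AllBlue : ∀ {n r} → Col n r → Set
AllBlue B = ∀ u i → B u i ≡ true

-- x and y lie in the same connected component of G^(r) - B
-- (a path from x to y all of whose vertices are white; x is assumed white)
data WConn {n} (G : Graph n) (r : ℕ) (B : Col n r) (x : V n r) : V n r → Set where
  here : WConn G r B x x
  step : ∀ {y z} → WConn G r B x y → AdjB G r y z → White B z → WConn G r B x z

-- Steps of the r-fold PSD forcing process.
-- The state carries the cluster of the vertex that has just performed a
-- force (if the previous step was an ordinary force), for backforcing.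

data Step {n} (G : Graph n) (r : ℕ) :
     Maybe (Fin n) → Col n r → Col n r → Maybe (Fin n) → Set where
  -- ordinary step: blue vertex v forces N(v) ∩ W, where W is the white
  -- component containing the white neighbour w of v; requires |N(v) ∩ W| ≤ r
  ordinary : ∀ {m B B'} (v w : V n r) →
    Blue B v → White B w → AdjB G r v w →
    let S : V n r → Set
        S x = White B x × AdjB G r v x × WConn G r B w x
    in
    (Σ (List (V n r)) λ L → length L ≤ r × (∀ x → S x → x ∈ L)) →
    (∀ x → (Blue B' x → Blue B x ⊎ S x) × (Blue B x ⊎ S x → Blue B' x)) →
    Step G r m B B' (just (cluster v))
  -- backforcing step: a vertex of cluster R_u (not entirely blue) has just
  -- performed a force; all of R_u is colored blue
  backforce : ∀ {B B'} (u : Fin n) → ¬ AllBlueCluster B u →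
    (∀ x → (Blue B' x → Blue B x ⊎ cluster x ≡ u) × (Blue B x ⊎ cluster x ≡ u → Blue B' x)) →
    Step G r (just u) B B' nothing

ClusterForced : ∀ {n r} → Col n r → Col n r → Fin n → Set
ClusterForced B B' u = Σ _ λ i → B u i ≡ false × B' u i ≡ true

ExactlyOneClusterForced : ∀ {n r} → Col n r → Col n r → Set
ExactlyOneClusterForced B B' =
  Σ _ λ u → ClusterForced B B' u × (∀ w → ClusterForced B B' w → w ≡ u)

data Process {n} (G : Graph n) (r : ℕ) (P : Col n r → Col n r → Set) :
     Maybe (Fin n) → Col n r → Set where
  done : ∀ {m B} → AllBlue B → Process G r P m B
  _∷_  : ∀ {m m' B B'} → Step G r m B B' m' × P B B' →
         Process G r P m' B' → Process G r P m B

NoCondition : ∀ {n r} → Col n r → Col n r → Set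
NoCondition _ _ = ⊤

IsForcingSet : ∀ {n} → Graph n → (r : ℕ) → Col n r → Set
IsForcingSet G r B = Process G r NoCondition nothing B

IsMinimumForcingSet : ∀ {n} → Graph n → (r : ℕ) → Col n r → Set
IsMinimumForcingSet G r B =
  IsForcingSet G r B × (∀ B' → IsForcingSet G r B' → size B ≤ size B')

AON : ∀ {n r} → Col n r → Set
AON {r = r} B = ∀ u → countFin (B u) ≡ r ⊎ countFin (B u) ≡ 1 ⊎ countFin (B u) ≡ 0

OptimalAON : ∀ {n} → Graph n → (r : ℕ) → Col n r → Set
OptimalAON G r B =
  AON B × IsMinimumForcingSet G r B × Process G r ExactlyOneClusterForced nothing B

aAll : ∀ {n r} → Col n r → ℕ
aAll B = countFin (λ u → allFin? (B u))

-- A minimum AON r-fold forcing set B with a(B) All and ℓ(B) One clusters has size r·a(B) + ℓ(B).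
-- A process forcing exactly one cluster per step can be imitated in any blowup G^(r') with r' ≥ 2
-- by the AON set with the same All and One clusters: a cluster that B forces while it still has a
-- white neighbour is forced entirely at once, otherwise its white vertices are forced one by one.
-- So each of B (in G^(r)) and B⋆ (in G^(n)) yields a forcing set of the other blowup, giving
--   n·a(B⋆) + ℓ(B⋆) ≤ n·a(B) + ℓ(B)   and   r·a(B) + ℓ(B) ≤ r·a(B⋆) + ℓ(B⋆).
-- Minimality also forces ℓ < n: if every cluster were a One cluster, removing the blue vertex of the
-- first forced cluster would leave a smaller forcing set. As ℓ < n ≤ r, the two inequalities
-- compare numbers written in bases n and r, and their leading digits a(B) and a(B⋆) must agree.
module Submission where

open import Defs
open import Data.Nat using (ℕ; zero; suc; _+_; _*_; _≤_; _<_; z≤n; s≤s; _≡ᵇ_)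
open import Data.Nat.Properties hiding (_≟_)
open import Algebra.Properties.CommutativeSemigroup +-commutativeSemigroup using (interchange)
open import Data.Bool using (Bool; true; false; if_then_else_; T; _∧_; _∨_)
open import Data.Bool.Properties using (¬-not; ∨-identityʳ; ∨-zeroʳ) renaming (_≟_ to _≟ᵇ_)
open import Data.Fin using (Fin; zero; suc; _≟_)
open import Data.Fin.Properties using (all?; any?; ¬∀⟶∃¬)
open import Data.Product using (Σ; ∃; _×_; _,_; proj₁; proj₂; map₂)
open import Data.Product.Properties using (≡-dec)
open import Data.Sum using (_⊎_; inj₁; inj₂; [_,_])
import Data.Sum as Sum
open import Data.Empty using (⊥; ⊥-elim)
open import Data.Unit using (tt)
open import Data.Maybe using (Maybe; just; nothing)
open import Data.List using (List; []; _∷_; length; tabulate; allFin)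
open import Data.List.Properties using (length-tabulate)
open import Data.List.Membership.Propositional using (_∈_)
open import Data.List.Membership.Propositional.Properties using (∈-tabulate⁺; ∈-allFin)
import Data.List.Relation.Unary.Any as Any
open import Function using (id; _∘′_)
open import Relation.Binary.PropositionalEquality hiding ([_])
open import Relation.Binary.Definitions using (DecidableEquality; tri<; tri≈; tri>)
open import Relation.Nullary using (¬_; Dec; does; yes; no; contradiction)
open import Relation.Nullary.Decidable using (_×-dec_)

sumFin-cong : ∀ {m} {f g : Fin m → ℕ} → (∀ i → f i ≡ g i) → sumFin f ≡ sumFin g
sumFin-cong {zero}  f≗g = refl
sumFin-cong {suc m} f≗g = cong₂ _+_ (f≗g zero) (sumFin-cong (λ i → f≗g (suc i)))

sumFin-+ : ∀ {m} (f g : Fin m → ℕ) → sumFin (λ i → f i + g i) ≡ sumFin f + sumFin g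
sumFin-+ {zero}  f g = refl
sumFin-+ {suc m} f g = begin
  f zero + g zero + sumFin (λ i → f (suc i) + g (suc i))
    ≡⟨ cong (f zero + g zero +_) (sumFin-+ (λ i → f (suc i)) (λ i → g (suc i))) ⟩
  f zero + g zero + (sumFin (λ i → f (suc i)) + sumFin (λ i → g (suc i)))
    ≡⟨ interchange (f zero) (g zero) _ _ ⟩
  sumFin f + sumFin g ∎
  where open ≡-Reasoning

sumFin-zero : ∀ m → sumFin {m} (λ _ → 0) ≡ 0
sumFin-zero zero    = refl
sumFin-zero (suc m) = sumFin-zero m

sumFin-indicator : ∀ {m} (p : Fin m → Bool) c →
  sumFin (λ i → if p i then c else 0) ≡ c * countFin p
sumFin-indicator {zero}  p c = sym (*-zeroʳ c)
sumFin-indicator {suc m} p c with p zero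
... | true  = trans (cong (c +_) (sumFin-indicator (λ i → p (suc i)) c)) (sym (*-suc c _))
... | false = sumFin-indicator (λ i → p (suc i)) c

sumFin-point : ∀ {m} (q : Fin m) (f : Fin m → ℕ) →
  sumFin (λ i → if does (i ≟ q) then f i else 0) ≡ f q
sumFin-point {suc m} zero    f = trans (cong (f zero +_) (sumFin-zero m)) (+-identityʳ (f zero))
sumFin-point {suc m} (suc q) f = sumFin-point q (λ i → f (suc i))

countFin-≤ : ∀ {m} (p : Fin m → Bool) → countFin p ≤ m
countFin-≤ {zero}  p = z≤n
countFin-≤ {suc m} p with p zero
... | true  = s≤s (countFin-≤ (λ i → p (suc i)))
... | false = m≤n⇒m≤1+n (countFin-≤ (λ i → p (suc i)))

countFin-false⇒< : ∀ {m} (p : Fin m → Bool) i → p i ≡ false → countFin p < m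
countFin-false⇒< {suc m} p zero    pᵢ rewrite pᵢ = s≤s (countFin-≤ (λ i → p (suc i)))
countFin-false⇒< {suc m} p (suc i) pᵢ with p zero
... | true  = s≤s (countFin-false⇒< (λ i → p (suc i)) i pᵢ)
... | false = m<n⇒m<1+n (countFin-false⇒< (λ i → p (suc i)) i pᵢ)

countFin≡m⇒true : ∀ {m} (p : Fin m → Bool) → countFin p ≡ m → ∀ i → p i ≡ true
countFin≡m⇒true p full i with p i in pᵢ
... | true  = refl
... | false = contradiction full (<⇒≢ (countFin-false⇒< p i pᵢ))

countFin≡0⇒false : ∀ {m} (p : Fin m → Bool) → countFin p ≡ 0 → ∀ i → p i ≡ false
countFin≡0⇒false {suc m} p c i with p zero in p₀
countFin≡0⇒false {suc m} p () i       | true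
countFin≡0⇒false {suc m} p c zero    | false = p₀
countFin≡0⇒false {suc m} p c (suc i) | false = countFin≡0⇒false (λ i → p (suc i)) c i

countFin-false : ∀ {m} (p : Fin m → Bool) → (∀ i → p i ≡ false) → countFin p ≡ 0
countFin-false {m} p none =
  trans (sumFin-cong (λ i → cong (λ b → if b then 1 else 0) (none i))) (sumFin-zero m)

countFin-true : ∀ {m} (p : Fin m → Bool) → (∀ i → p i ≡ true) → countFin p ≡ m
countFin-true {zero}  p all = refl
countFin-true {suc m} p all rewrite all zero =
  cong suc (countFin-true (λ i → p (suc i)) (λ i → all (suc i)))

allFin?-sound : ∀ {m} (p : Fin m → Bool) → allFin? p ≡ true → ∀ i → p i ≡ true
allFin?-sound {suc m} p all i with p zero in p₀
allFin?-sound {suc m} p all zero    | true = p₀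
allFin?-sound {suc m} p all (suc i) | true = allFin?-sound (λ i → p (suc i)) all i

allFin?-complete : ∀ {m} (p : Fin m → Bool) → (∀ i → p i ≡ true) → allFin? p ≡ true
allFin?-complete {zero}  p all = refl
allFin?-complete {suc m} p all rewrite all zero =
  allFin?-complete (λ i → p (suc i)) (λ i → all (suc i))

≡true⇒≢false : ∀ {b : Bool} → b ≡ true → b ≢ false
≡true⇒≢false refl ()

HasWhite : ∀ {n r} → Col n r → Fin n → Set
HasWhite B u = ∃ λ i → B u i ≡ false

allBlue-or-hasWhite : ∀ {n r} (B : Col n r) u → AllBlueCluster B u ⊎ HasWhite B u
allBlue-or-hasWhite B u with all? (λ i → B u i ≟ᵇ true)
... | yes full  = inj₁ full
... | no ¬full = inj₂ (map₂ ¬-not (¬∀⟶∃¬ _ _ (λ i → B u i ≟ᵇ true) ¬full))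

allFin?-false⇒hasWhite : ∀ {n r} (B : Col n r) u → allFin? (B u) ≡ false → HasWhite B u
allFin?-false⇒hasWhite B u notAll with allBlue-or-hasWhite B u
... | inj₁ full  = ⊥-elim (≡true⇒≢false (allFin?-complete (B u) full) notAll)
... | inj₂ white = white

isAllCluster : ∀ {n r} → Col n r → Fin n → Bool
isAllCluster B u = allFin? (B u)

-- All clusters are excluded so that, for r = 1, no cluster is counted as both All and One.
isOneCluster : ∀ {n r} → Col n r → Fin n → Bool
isOneCluster B u = if isAllCluster B u then false else countFin (B u) ≡ᵇ 1

ℓOne : ∀ {n r} → Col n r → ℕ
ℓOne B = countFin (isOneCluster B)

isOneCluster⇒single : ∀ {n r} (B : Col n r) u → isOneCluster B u ≡ true → countFin (B u) ≡ 1
isOneCluster⇒single B u isOne with isAllCluster B u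
... | false = ≡ᵇ⇒≡ _ 1 (subst T (sym isOne) tt)

data AONKind {n r} (B : Col n r) (u : Fin n) : Bool → Bool → Set where
  all  : AllBlueCluster B u → AONKind B u true false
  one  : countFin (B u) ≡ 1 → HasWhite B u → AONKind B u false true
  none : (∀ i → B u i ≡ false) → HasWhite B u → AONKind B u false false

aonKind : ∀ {n r} {B : Col n r} → AON B → ∀ u →
  AONKind B u (isAllCluster B u) (isOneCluster B u)
aonKind {B = B} aon u with allFin? (B u) in allᵤ
... | true = all (allFin?-sound (B u) allᵤ)
... | false with countFin (B u) ≡ᵇ 1 in oneᵤ | aon u
...   | true  | _ = one (≡ᵇ⇒≡ _ 1 (subst T (sym oneᵤ) tt)) (allFin?-false⇒hasWhite B u allᵤ)
...   | false | inj₁ full =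
        ⊥-elim (≡true⇒≢false (allFin?-complete (B u) (countFin≡m⇒true (B u) full)) allᵤ)
...   | false | inj₂ (inj₁ single) = contradiction (≡⇒≡ᵇ _ 1 single) (subst T oneᵤ)
...   | false | inj₂ (inj₂ empty)  =
        none (countFin≡0⇒false (B u) empty) (allFin?-false⇒hasWhite B u allᵤ)

kindCount : ℕ → Bool → Bool → ℕ
kindCount r a o = (if a then r else 0) + (if o then 1 else 0)

countFin-kind : ∀ {n r} {B : Col n r} {u a o} → AONKind B u a o → countFin (B u) ≡ kindCount r a o
countFin-kind {r = r} {B} {u} (all full) = trans (countFin-true (B u) full) (sym (+-identityʳ r))
countFin-kind (one single _)             = single
countFin-kind {B = B} {u} (none empty _) = countFin-false (B u) empty

size-by-kind : ∀ {n r r'} (B : Col n r) (C : Col n r') →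
  (∀ u → countFin (C u) ≡ kindCount r' (isAllCluster B u) (isOneCluster B u)) →
  size C ≡ r' * aAll B + ℓOne B
size-by-kind {r' = r'} B C count = begin
  size C
    ≡⟨ sumFin-cong count ⟩
  sumFin (λ u → allPart u + onePart u)
    ≡⟨ sumFin-+ allPart onePart ⟩
  sumFin allPart + sumFin onePart
    ≡⟨ cong₂ _+_ (sumFin-indicator (isAllCluster B) r')
                 (trans (sumFin-indicator (isOneCluster B) 1) (*-identityˡ _)) ⟩
  r' * aAll B + ℓOne B ∎
  where
    open ≡-Reasoning
    allPart onePart : _ → ℕ
    allPart u = if isAllCluster B u then r' else 0
    onePart u = if isOneCluster B u then 1 else 0

size-AON : ∀ {n r} {B : Col n r} → AON B → size B ≡ r * aAll B + ℓOne B
size-AON {B = B} aon = size-by-kind B B (λ u → countFin-kind (aonKind aon u))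

canonicalCluster : ∀ {r'} → Bool → Bool → Fin (suc r') → Bool
canonicalCluster a o j = a ∨ (o ∧ does (j ≟ zero))

canonical : ∀ {n r r'} → Col n r → Col n (suc r')
canonical B u = canonicalCluster (isAllCluster B u) (isOneCluster B u)

countFin-canonicalCluster : ∀ {n r r'} {B : Col n r} {u a o} → AONKind B u a o →
  countFin (canonicalCluster {r'} a o) ≡ kindCount (suc r') a o
countFin-canonicalCluster {r' = r'} (all _)    =
  trans (countFin-true (λ _ → true) (λ _ → refl)) (sym (+-identityʳ (suc r')))
countFin-canonicalCluster {r' = r'} (one _ _)  = sumFin-point {suc r'} zero (λ _ → 1)
countFin-canonicalCluster {r' = r'} (none _ _) = sumFin-zero (suc r')

size-canonical : ∀ {n r r'} {B : Col n r} → AON B →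
  size (canonical {r' = r'} B) ≡ suc r' * aAll B + ℓOne B
size-canonical {r' = r'} {B} aon =
  size-by-kind B (canonical {r' = r'} B) (λ u → countFin-canonicalCluster {r' = r'} (aonKind aon u))

canonical-all : ∀ {n r r'} {B : Col n r} {u a o} → AllBlueCluster B u → AONKind B u a o →
  ∀ j → canonicalCluster {r'} a o j ≡ true
canonical-all full (all _)           j = refl
canonical-all full (one _ (i , ui))  j = ⊥-elim (≡true⇒≢false (full i) ui)
canonical-all full (none _ (i , ui)) j = ⊥-elim (≡true⇒≢false (full i) ui)

canonical-blue : ∀ {n r r'} {B : Col n r} {u a o i} → B u i ≡ true → AONKind B u a o →
  canonicalCluster {r'} a o zero ≡ true
canonical-blue ui (all _)   = refl
canonical-blue ui (one _ _) = refl
canonical-blue {i = i} ui (none empty _) = ⊥-elim (≡true⇒≢false ui (empty i))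

canonical-white : ∀ {n r r₂} {B : Col n r} {u a o i} → B u i ≡ false → AONKind B u a o →
  ∃ λ j → canonicalCluster {suc r₂} a o j ≡ false
canonical-white {i = i} ui (all full) = ⊥-elim (≡true⇒≢false (full i) ui)
canonical-white ui (one _ _)  = suc zero , refl
canonical-white ui (none _ _) = zero , refl

InCluster : ∀ {n r} → Fin n → V n r → Set
InCluster q x = cluster x ≡ q

IsUnion : ∀ {n r} → Col n r → Col n r → (V n r → Set) → Set
IsUnion B' B S = ∀ x → (Blue B' x → Blue B x ⊎ S x) × (Blue B x ⊎ S x → Blue B' x)

IsUnion-cong : ∀ {n r} {B B' : Col n r} {S T : V n r → Set} →
  (∀ x → S x → Blue B x ⊎ T x) → (∀ x → T x → Blue B x ⊎ S x) → IsUnion B' B S → IsUnion B' B T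
IsUnion-cong S⊆B∪T T⊆B∪S union x =
  [ inj₁ , S⊆B∪T x ] ∘′ proj₁ (union x) ,
  [ proj₂ (union x) ∘′ inj₁ , proj₂ (union x) ∘′ T⊆B∪S x ]

AgreesOff : ∀ {n r} → Fin n → Col n r → Col n r → Set
AgreesOff q C' C = ∀ u j → u ≢ q → C' u j ≡ C u j

fillCluster : ∀ {n r} → Col n r → Fin n → Col n r
fillCluster C q u j = if does (u ≟ q) then true else C u j

fillCluster-full : ∀ {n r} (C : Col n r) q → AllBlueCluster (fillCluster C q) q
fillCluster-full C q j with q ≟ q
... | yes _    = refl
... | no q≢q = contradiction refl q≢q

fillCluster-agrees : ∀ {n r} (C : Col n r) q → AgreesOff q (fillCluster C q) C
fillCluster-agrees C q u j u≢q with u ≟ q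
... | yes u≡q = contradiction u≡q u≢q
... | no _    = refl

fillCluster-isUnion : ∀ {n r} (C : Col n r) q → IsUnion (fillCluster C q) C (InCluster q)
fillCluster-isUnion C q (u , j) with u ≟ q
... | yes u≡q = (λ _ → inj₂ u≡q) , (λ _ → refl)
... | no u≢q  = inj₁ , [ id , (λ u≡q → contradiction u≡q u≢q) ]

clearCluster : ∀ {n r} → Col n r → Fin n → Col n r
clearCluster C q u j = if does (u ≟ q) then false else C u j

clearCluster-agrees : ∀ {n r} (C : Col n r) q → AgreesOff q (clearCluster C q) C
clearCluster-agrees C q u j u≢q with u ≟ q
... | yes u≡q = contradiction u≡q u≢q
... | no _    = refl

clearCluster-empty : ∀ {n r} (C : Col n r) q j → clearCluster C q q j ≡ false
clearCluster-empty C q j with q ≟ q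
... | yes _    = refl
... | no q≢q = contradiction refl q≢q

size-clearCluster : ∀ {n r} (C : Col n r) q → size (clearCluster C q) + countFin (C q) ≡ size C
size-clearCluster {r = r} C q = begin
  size (clearCluster C q) + countFin (C q)
    ≡⟨ cong (size (clearCluster C q) +_) (sym (sumFin-point q (λ u → countFin (C u)))) ⟩
  size (clearCluster C q) + sumFin atQ
    ≡⟨ sym (sumFin-+ (λ u → countFin (clearCluster C q u)) atQ) ⟩
  sumFin (λ u → countFin (clearCluster C q u) + atQ u)
    ≡⟨ sumFin-cong split ⟩
  size C ∎
  where
    open ≡-Reasoning
    atQ : Fin _ → ℕ
    atQ u = if does (u ≟ q) then countFin (C u) else 0
    split : ∀ u → countFin (clearCluster C q u) + atQ u ≡ countFin (C u)
    split u with u ≟ q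
    ... | yes _ = cong (_+ countFin (C u)) (sumFin-zero r)
    ... | no _  = +-identityʳ (countFin (C u))

_≟ⱽ_ : ∀ {n r} → DecidableEquality (V n r)
_≟ⱽ_ = ≡-dec _≟_ _≟_

paint : ∀ {n r} → Col n r → V n r → Col n r
paint C v u j = C u j ∨ does ((u , j) ≟ⱽ v)

paint-keeps : ∀ {n r} (C : Col n r) v u j → C u j ≡ true → paint C v u j ≡ true
paint-keeps C v u j blue rewrite blue = refl

paint-colours : ∀ {n r} (C : Col n r) (v : V n r) → Blue (paint C v) v
paint-colours C (q , k) with (q , k) ≟ⱽ (q , k)
... | yes _   = ∨-zeroʳ (C q k)
... | no v≢v = contradiction refl v≢v

paint-agrees : ∀ {n r} (C : Col n r) q k → AgreesOff q (paint C (q , k)) C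
paint-agrees C q k u j u≢q with (u , j) ≟ⱽ (q , k)
... | yes refl = contradiction refl u≢q
... | no _     = ∨-identityʳ (C u j)

Process-forget : ∀ {n r P m B} {G : Graph n} → Process G r P m B → Process G r NoCondition m B
Process-forget (done full)      = done full
Process-forget ((s , _) ∷ rest) = (s , tt) ∷ Process-forget rest

HasMinimumSize : ∀ {n} → Graph n → (r : ℕ) → Col n r → Set
HasMinimumSize G r B = ∀ B' → IsForcingSet G r B' → size B ≤ size B'

module _ {n : ℕ} (G : Graph n) where

  adj-sym : ∀ {u w} → adj G u w ≡ true → adj G w u ≡ true
  adj-sym {u} {w} uw = trans (symm G w u) uw

  adj⇒≢ : ∀ {u w} → adj G u w ≡ true → u ≢ w
  adj⇒≢ {u} uu refl = ≡true⇒≢false uu (irrefl G u)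

  ForcedBy : ∀ {r} → Col n r → Fin n → V n r → V n r → Set
  ForcedBy {r} B p w x = White B x × adj G p (cluster x) ≡ true × WConn G r B w x

  Confined : ∀ {r} → Col n r → Fin n → V n r → Fin n → Set
  Confined B p w q = ∀ x → ForcedBy B p w x → InCluster q x

  NeighboursBlue : ∀ {r} → Col n r → Fin n → Set
  NeighboursBlue D q = ∀ x j → adj G q x ≡ true → D x j ≡ true

  WhiteReflected : ∀ {r r'} → Col n r' → Col n r → Set
  WhiteReflected D B = ∀ u j → D u j ≡ false → HasWhite B u

  white-path-via : ∀ {r} {D : Col n r} {q x i j k} →
    adj G q x ≡ true → D x j ≡ false → D q k ≡ false → WConn G r D (q , i) (q , k)
  white-path-via qx xj qk = step (step here qx xj) (adj-sym qx) qk

  white-path-isolated : ∀ {r} {D : Col n r} {q k} → NeighboursBlue D q →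
    ∀ {y} → WConn G r D (q , k) y → y ≡ (q , k)
  white-path-isolated isolated here = refl
  white-path-isolated isolated (step path yz z-white) with white-path-isolated isolated path
  ... | refl = ⊥-elim (≡true⇒≢false (isolated _ _ yz) z-white)

  white-path-lift : ∀ {r r'} {B : Col n r} {D : Col n r'} → WhiteReflected D B →
    ∀ {w w̃ x̃} → White B w → cluster w ≡ cluster w̃ → WConn G r' D w̃ x̃ →
    ∃ λ y → WConn G r B w y × White B y × cluster y ≡ cluster x̃
  white-path-lift reflect {w} w-white same here = w , here , w-white , same
  white-path-lift reflect w-white same (step {z = z₁ , _} path yz z-white)
    with white-path-lift reflect w-white same path
  ... | _ , path′ , _ , refl with reflect z₁ _ z-white
  ...   | i , z₁ᵢ = (z₁ , i) , step path′ yz z₁ᵢ , z₁ᵢ , refl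

  Confined-lift : ∀ {r r'} {B : Col n r} {D : Col n r'} {p q k k̃} →
    WhiteReflected D B → B q k ≡ false → Confined B p (q , k) q → Confined D p (q , k̃) q
  Confined-lift reflect qk confined (x , _) (_ , px , path) with white-path-lift reflect qk refl path
  ... | (_ , l) , path′ , xₗ , refl = confined (x , l) (xₗ , px , path′)

  bounded-by-cluster : ∀ {r} {S : V n r → Set} q → (∀ x → S x → InCluster q x) →
    Σ (List (V n r)) λ L → length L ≤ r × (∀ x → S x → x ∈ L)
  bounded-by-cluster {r} q inside = tabulate (q ,_) , ≤-reflexive (length-tabulate (q ,_)) , member
    where
      member : ∀ x → _ → x ∈ tabulate (q ,_)
      member (u , j) s with inside (u , j) s
      ... | refl = ∈-tabulate⁺ j

  fill-cluster-step : ∀ {r m} {D : Col n r} {p q x : Fin n} {j k l : Fin r} →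
    D p j ≡ true → D q k ≡ false → adj G p q ≡ true → adj G q x ≡ true → D x l ≡ false →
    Confined D p (q , k) q → Step G r m D (fillCluster D q) (just p)
  fill-cluster-step {D = D} {p} {q} {j = j} {k} pj qk pq qx xl confined =
    ordinary (p , j) (q , k) pj qk pq (bounded-by-cluster q confined)
      (IsUnion-cong cluster-forced (λ y → inj₂ ∘′ confined y) (fillCluster-isUnion D q))
    where
      cluster-forced : ∀ y → InCluster q y → Blue D y ⊎ ForcedBy D p (q , k) y
      cluster-forced (_ , i) refl with D q i in qi
      ... | true  = inj₁ refl
      ... | false = inj₂ (refl , pq , white-path-via qx xl qi)

  paint-vertex-step : ∀ {r m} {D : Col n r} {p q : Fin n} {j k : Fin r} →
    D p j ≡ true → D q k ≡ false → adj G p q ≡ true → NeighboursBlue D q →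
    Step G r m D (paint D (q , k)) (just p)
  paint-vertex-step {D = D} {p} {q} {j} {k} pj qk pq isolated =
    ordinary (p , j) (q , k) pj qk pq (bounded-by-cluster q (λ y → cong proj₁ ∘′ only-qk y)) union
    where
      only-qk : ∀ y → ForcedBy D p (q , k) y → y ≡ (q , k)
      only-qk y (_ , _ , path) = white-path-isolated isolated path
      painted : ∀ u i → Blue (paint D (q , k)) (u , i) → Blue D (u , i) ⊎ ForcedBy D p (q , k) (u , i)
      painted u i b with D u i | (u , i) ≟ⱽ (q , k)
      painted u i _  | true  | _        = inj₁ refl
      painted u i _  | false | yes refl = inj₂ (refl , pq , here)
      painted u i () | false | no _
      union : IsUnion (paint D (q , k)) D (ForcedBy D p (q , k))
      union (u , i) = painted u i , [ paint-keeps D _ u i , forced ]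
        where
          forced : ForcedBy D p (q , k) (u , i) → Blue (paint D (q , k)) (u , i)
          forced f = subst (Blue (paint D (q , k))) (sym (only-qk _ f)) (paint-colours D (q , k))

  fill-isolated-cluster : ∀ {r m} {D : Col n r} {p q : Fin n} {j k : Fin r} →
    D p j ≡ true → D q k ≡ false → adj G p q ≡ true → NeighboursBlue D q →
    (∀ D' → AgreesOff q D' D → AllBlueCluster D' q → Process G r NoCondition (just p) D') →
    Process G r NoCondition m D
  fill-isolated-cluster {r} {D = D} {p} {q} {j} {k} pj qk pq isolated finish =
    (paint-vertex-step pj qk pq isolated , tt) ∷
      fill (allFin r) (paint D (q , k)) (paint-agrees D q k) (λ i → inj₁ (∈-allFin i))
    where
      uncover : ∀ {i is} {c c′ : Fin r → Bool} → (∀ i′ → i′ ∈ i ∷ is ⊎ c i′ ≡ true) →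
                c′ i ≡ true → (∀ i′ → c i′ ≡ true → c′ i′ ≡ true) →
                ∀ i′ → i′ ∈ is ⊎ c′ i′ ≡ true
      uncover covered i-blue grow i′ with covered i′
      ... | inj₁ (Any.here refl)   = inj₂ i-blue
      ... | inj₁ (Any.there i′∈is) = inj₁ i′∈is
      ... | inj₂ blue              = inj₂ (grow i′ blue)

      fill : (is : List (Fin r)) (E : Col n r) → AgreesOff q E D →
             (∀ i → i ∈ is ⊎ E q i ≡ true) → Process G r NoCondition (just p) E
      fill []       E agree covered = finish E agree (λ i → [ (λ ()) , id ] (covered i))
      fill (i ∷ is) E agree covered with E q i in qi
      ... | true  = fill is E agree (uncover covered qi (λ _ → id))
      ... | false =
        (paint-vertex-step Ep qi pq E-isolated , tt) ∷
          fill is (paint E (q , i)) (λ u l u≢q → trans (paint-agrees E q i u l u≢q) (agree u l u≢q))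
            (uncover covered (paint-colours E (q , i)) (paint-keeps E (q , i) q))
        where
          Ep : E p j ≡ true
          Ep = trans (agree p j (adj⇒≢ pq)) pj
          E-isolated : NeighboursBlue E q
          E-isolated x l qx = trans (agree x l (adj⇒≢ (adj-sym qx))) (isolated x l qx)

  clear-forced-step : ∀ {r m} {B B₁ : Col n r} {p q : Fin n} {i k l : Fin r} →
    B p i ≡ true → B q k ≡ false → adj G p q ≡ true → B p l ≡ false →
    IsUnion B₁ B (ForcedBy B p (q , k)) → Confined B p (q , k) q →
    Step G r m (clearCluster B q) B₁ (just p)
  clear-forced-step {B = B} {B₁} {p} {q} {i} {k} {l} pi qk pq pl union confined =
    ordinary (p , i) (q , k) (trans (clearCluster-agrees B q p i p≢q) pi) (clearCluster-empty B q k) pq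
      (bounded-by-cluster q confined′)
      (IsUnion-cong cluster-forced (λ y → inj₂ ∘′ confined′ y) union-cluster)
    where
      B′ = clearCluster B q
      p≢q = adj⇒≢ pq
      keeps : ∀ u j → B u j ≡ true → B₁ u j ≡ true
      keeps u j b = proj₂ (union (u , j)) (inj₁ b)
      reflect : WhiteReflected B′ B
      reflect u j uj with u ≟ q
      ... | yes refl = k , qk
      ... | no _     = j , uj
      confined′ : Confined B′ p (q , k) q
      confined′ = Confined-lift reflect qk confined
      q-full : AllBlueCluster B₁ q
      q-full j with B q j in qj
      ... | true  = keeps q j qj
      ... | false = proj₂ (union (q , j)) (inj₂ (qj , pq , white-path-via (adj-sym pq) pl qj))
      union-cluster : IsUnion B₁ B′ (InCluster q)
      union-cluster (u , j) with u ≟ q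
      ... | yes refl = (λ _ → inj₂ refl) , (λ _ → q-full j)
      ... | no u≢q  = (λ b → [ inj₁ , (λ f → contradiction (confined _ f) u≢q) ] (proj₁ (union _) b))
                    , [ keeps u j , (λ u≡q → contradiction u≡q u≢q) ]
      cluster-forced : ∀ y → InCluster q y → Blue B′ y ⊎ ForcedBy B′ p (q , k) y
      cluster-forced (_ , j) refl =
        inj₂ (clearCluster-empty B q j , pq , white-path-via (adj-sym pq) pl′ (clearCluster-empty B q j))
        where pl′ = trans (clearCluster-agrees B q p l p≢q) pl

  confined-by-uniqueness : ∀ {r} {B B' : Col n r} {p q k} →
    IsUnion B' B (ForcedBy B p (q , k)) → ExactlyOneClusterForced B B' →
    B q k ≡ false → adj G p q ≡ true → Confined B p (q , k) q
  confined-by-uniqueness {q = q} {k} union (_ , _ , unique) qk pq (x₁ , x₂) forced =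
    trans (unique x₁ (x₂ , proj₁ forced , proj₂ (union _) (inj₂ forced)))
          (sym (unique q (k , qk , proj₂ (union _) (inj₂ (qk , pq , here)))))

  record Simulates {r r'} (B : Col n r) (C : Col n r') : Set where
    field
      all-blue       : ∀ u → AllBlueCluster B u → AllBlueCluster C u
      some-blue      : ∀ u i → B u i ≡ true → ∃ λ j → C u j ≡ true
      frontier-white : ∀ u i x j → B u i ≡ false → adj G u x ≡ true → B x j ≡ false → HasWhite C u
  open Simulates

  white-reflected : ∀ {r r'} {B : Col n r} {C : Col n r'} → Simulates B C → WhiteReflected C B
  white-reflected {B = B} sim u j uj with allBlue-or-hasWhite B u
  ... | inj₁ full  = ⊥-elim (≡true⇒≢false (all-blue sim u full j) uj)
  ... | inj₂ white = white

  frontier-full : ∀ {r r'} {B : Col n r} {C : Col n r'} {p q k} → Simulates B C →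
    AllBlueCluster C q → B q k ≡ false → adj G q p ≡ true → AllBlueCluster B p
  frontier-full {B = B} {p = p} {q} {k} sim q-full qk qp l with B p l in pl
  ... | true  = refl
  ... | false with frontier-white sim q k p l qk qp pl
  ...   | k̃ , qk̃ = ⊥-elim (≡true⇒≢false (q-full k̃) qk̃)

  still-white : ∀ {r} {B B' : Col n r} → (∀ u j → B u j ≡ true → B' u j ≡ true) →
    ∀ u j → B' u j ≡ false → B u j ≡ false
  still-white {B = B} keeps u j u′ with B u j in uj
  ... | false = refl
  ... | true  = ⊥-elim (≡true⇒≢false (keeps u j uj) u′)

  record ForcesCluster {r} (q : Fin n) (B B' : Col n r) : Set where
    field
      keeps   : ∀ u j → B u j ≡ true → B' u j ≡ true
      only-in : ∀ u j → B' u j ≡ true → B u j ≡ true ⊎ u ≡ q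
      settled : ∀ i x j → B' q i ≡ false → adj G q x ≡ true → B' x j ≡ false → ⊥
  open ForcesCluster

  ordinary-forcesCluster : ∀ {r} {B B' : Col n r} {p q k} → adj G p q ≡ true →
    IsUnion B' B (ForcedBy B p (q , k)) → Confined B p (q , k) q → ForcesCluster q B B'
  ordinary-forcesCluster {B = B} {B'} {p} {q} {k} pq union confined = record
    { keeps = keeps′ ; only-in = only-in′ ; settled = settled′ }
    where
      keeps′ : ∀ u j → B u j ≡ true → B' u j ≡ true
      keeps′ u j b = proj₂ (union (u , j)) (inj₁ b)
      only-in′ : ∀ u j → B' u j ≡ true → B u j ≡ true ⊎ u ≡ q
      only-in′ u j b′ = Sum.map₂ (confined (u , j)) (proj₁ (union (u , j)) b′)
      settled′ : ∀ l x j → B' q l ≡ false → adj G q x ≡ true → B' x j ≡ false → ⊥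
      settled′ l x j ql qx xj = ≡true⇒≢false forced ql
        where
          forced : B' q l ≡ true
          forced = proj₂ (union (q , l))
            (inj₂ (still-white keeps′ q l ql , pq ,
                   white-path-via qx (still-white keeps′ x j xj) (still-white keeps′ q l ql)))

  backforce-forcesCluster : ∀ {r} {B B' : Col n r} {u} →
    IsUnion B' B (InCluster u) → ForcesCluster u B B'
  backforce-forcesCluster {u = u} union = record
    { keeps   = λ w j b → proj₂ (union (w , j)) (inj₁ b)
    ; only-in = λ w j b′ → proj₁ (union (w , j)) b′
    ; settled = λ i _ _ ui _ _ → ≡true⇒≢false (proj₂ (union (u , i)) (inj₂ refl)) ui
    }

  Simulates-step : ∀ {r r₀ q} {B B' : Col n r} {C C' : Col n (suc r₀)} →
    ForcesCluster q B B' → AgreesOff q C' C → AllBlueCluster C' q → Simulates B C → Simulates B' C'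
  Simulates-step {q = q} {B} {B'} {C} {C'} grows agree q-full sim = record
    { all-blue = all-blue′ ; some-blue = some-blue′ ; frontier-white = frontier-white′ }
    where
      all-blue′ : ∀ u → AllBlueCluster B' u → AllBlueCluster C' u
      all-blue′ u u-full with u ≟ q
      ... | yes refl = q-full
      ... | no u≢q  = λ j → trans (agree u j u≢q) (all-blue sim u before j)
        where
          before : AllBlueCluster B u
          before i = [ id , (λ u≡q → contradiction u≡q u≢q) ] (only-in grows u i (u-full i))
      some-blue′ : ∀ u i → B' u i ≡ true → ∃ λ j → C' u j ≡ true
      some-blue′ u i ui with u ≟ q | only-in grows u i ui
      ... | yes refl | _       = zero , q-full zero
      ... | no u≢q  | inj₂ u≡q = contradiction u≡q u≢q
      ... | no u≢q  | inj₁ ui′ with some-blue sim u i ui′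
      ...   | j , uj = j , trans (agree u j u≢q) uj
      frontier-white′ : ∀ u i x j → B' u i ≡ false → adj G u x ≡ true → B' x j ≡ false → HasWhite C' u
      frontier-white′ u i x j ui ux xj with u ≟ q
      ... | yes refl = ⊥-elim (settled grows i x j ui ux xj)
      ... | no u≢q
        with frontier-white sim u i x j (still-white (keeps grows) u i ui) ux (still-white (keeps grows) x j xj)
      ...   | k , uk = k , trans (agree u k u≢q) uk

  -- The simulated process may backforce from m only if the simulating one may backforce from m̃,
  -- unless the cluster m is already entirely blue, when such a backforce is impossible.
  BackforceMatch : ∀ {r} → Col n r → Maybe (Fin n) → Maybe (Fin n) → Set
  BackforceMatch B m m̃ = m ≡ nothing ⊎ m̃ ≡ m ⊎ ∃ λ p → m ≡ just p × AllBlueCluster B p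

  Continuation : ∀ {r} (r' : ℕ) → Col n r → Maybe (Fin n) → Set
  Continuation r' B m =
    ∀ {m̃} {C : Col n r'} → Simulates B C → BackforceMatch B m m̃ → Process G r' NoCondition m̃ C

  -- If R_q is already full in C the step is skipped (and then R_p is full in B, by frontier-white);
  -- if R_q has a white neighbour in C its white vertices are one component, forced at once;
  -- otherwise they are forced one at a time.
  simulate-ordinary : ∀ {r r₀ m̃} {B B' : Col n r} {C : Col n (suc r₀)} {p q i k} →
    B p i ≡ true → B q k ≡ false → adj G p q ≡ true →
    IsUnion B' B (ForcedBy B p (q , k)) → Confined B p (q , k) q →
    Simulates B C → Continuation (suc r₀) B' (just p) → Process G (suc r₀) NoCondition m̃ C
  simulate-ordinary {r₀ = r₀} {m̃} {B} {B'} {C} {p} {q} {i} {k} pi qk pq union confined sim continue =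
    by-colour-of-q (allBlue-or-hasWhite C q)
    where
      grows : ForcesCluster q B B'
      grows = ordinary-forcesCluster pq union confined
      pj = proj₂ (some-blue sim p i pi)
      continue-filled : ∀ {C′ : Col n (suc r₀)} → AgreesOff q C′ C → AllBlueCluster C′ q →
                        Process G (suc r₀) NoCondition (just p) C′
      continue-filled agree full = continue (Simulates-step grows agree full sim) (inj₂ (inj₁ refl))
      by-neighbours : ∀ {k̃} → C q k̃ ≡ false → Dec (∃ λ x → adj G q x ≡ true × HasWhite C x) →
                      Process G (suc r₀) NoCondition m̃ C
      by-neighbours qk̃ (yes (x , qx , l , xl)) =
        (fill-cluster-step pj qk̃ pq qx xl (Confined-lift (white-reflected sim) qk confined) , tt) ∷
          continue-filled (fillCluster-agrees C q) (fillCluster-full C q)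
      by-neighbours qk̃ (no no-white-neighbour) =
        fill-isolated-cluster pj qk̃ pq isolated (λ _ → continue-filled)
        where
          isolated : NeighboursBlue C q
          isolated x l qx = ¬-not λ xl → no-white-neighbour (x , qx , l , xl)
      by-colour-of-q : AllBlueCluster C q ⊎ HasWhite C q → Process G (suc r₀) NoCondition m̃ C
      by-colour-of-q (inj₁ q-full) =
        continue (Simulates-step grows (λ _ _ _ → refl) q-full sim)
          (inj₂ (inj₂ (p , refl , λ l → keeps grows p l (frontier-full sim q-full qk (adj-sym pq) l))))
      by-colour-of-q (inj₂ (_ , qk̃)) =
        by-neighbours qk̃ (any? λ x → (adj G q x ≟ᵇ true) ×-dec any? (λ l → C x l ≟ᵇ false))

  simulate-backforce : ∀ {r r₀ m̃} {B B' : Col n r} {C : Col n (suc r₀)} {u} →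
    ¬ AllBlueCluster B u → IsUnion B' B (InCluster u) → Simulates B C → BackforceMatch B (just u) m̃ →
    Continuation (suc r₀) B' nothing → Process G (suc r₀) NoCondition m̃ C
  simulate-backforce not-full union sim (inj₁ ()) continue
  simulate-backforce not-full union sim (inj₂ (inj₂ (_ , refl , full))) continue =
    contradiction full not-full
  simulate-backforce {C = C} {u} not-full union sim (inj₂ (inj₁ refl)) continue
    with allBlue-or-hasWhite C u
  ... | inj₁ u-full =
    continue (Simulates-step grows (λ _ _ _ → refl) u-full sim) (inj₁ refl)
    where grows = backforce-forcesCluster union
  ... | inj₂ (j , uj) =
    (backforce u (λ full → ≡true⇒≢false (full j) uj) (fillCluster-isUnion C u) , tt) ∷
      continue (Simulates-step grows (fillCluster-agrees C u) (fillCluster-full C u) sim) (inj₁ refl)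
    where grows = backforce-forcesCluster union

  simulate : ∀ {r r₀ m m̃} {B : Col n r} {C : Col n (suc r₀)} →
    Process G r ExactlyOneClusterForced m B → Simulates B C → BackforceMatch B m m̃ →
    Process G (suc r₀) NoCondition m̃ C
  simulate (done full) sim _ = done (λ u → all-blue sim u (full u))
  simulate ((ordinary (p , _) (q , k) pi qk pq _ union , unique) ∷ rest) sim _ =
    simulate-ordinary pi qk pq union (confined-by-uniqueness union unique qk pq) sim
      (λ sim′ match → simulate rest sim′ match)
  simulate ((backforce u not-full union , _) ∷ rest) sim match =
    simulate-backforce not-full union sim match (λ sim′ match → simulate rest sim′ match)

  simulates-canonical : ∀ {r r₂} {B : Col n r} → AON B → Simulates B (canonical {r' = suc r₂} B)
  simulates-canonical {r₂ = r₂} aon = record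
    { all-blue       = λ u full → canonical-all full (aonKind aon u)
    ; some-blue      = λ u i ui → zero , canonical-blue {r' = suc r₂} ui (aonKind aon u)
    ; frontier-white = λ u i _ _ ui _ _ → canonical-white ui (aonKind aon u)
    }

  canonical-size-bound : ∀ {r r'} {B : Col n r} {B⋆ : Col n (suc (suc r'))} → AON B → AON B⋆ →
    Process G r ExactlyOneClusterForced nothing B → HasMinimumSize G _ B⋆ →
    suc (suc r') * aAll B⋆ + ℓOne B⋆ ≤ suc (suc r') * aAll B + ℓOne B
  canonical-size-bound {r' = r'} {B} {B⋆} aon aon⋆ process minimum⋆ =
    subst₂ _≤_ (size-AON {B = B⋆} aon⋆) (size-canonical {r' = suc r'} aon)
      (minimum⋆ (canonical {r' = suc r'} B) (simulate process (simulates-canonical aon) (inj₁ refl)))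

-- Clearing the cluster that is forced first leaves a smaller forcing set: the same force still
-- colours all of it, through the white vertex of the forcing cluster.
all-one-not-minimum : ∀ {n r} (G : Graph (suc n)) {B : Col (suc n) (suc (suc r))} →
  (∀ u → countFin (B u) ≡ 1) → Process G _ ExactlyOneClusterForced nothing B → ¬ HasMinimumSize G _ B
all-one-not-minimum G {B} single (done full) _ =
  contradiction (trans (sym (countFin-true (B zero) (full zero))) (single zero)) λ ()
all-one-not-minimum G {B} single ((ordinary (p , i) (q , k) pi qk pq _ union , unique) ∷ rest) minimum
  with allBlue-or-hasWhite B p
... | inj₁ p-full = contradiction (trans (sym (countFin-true (B p) p-full)) (single p)) λ ()
... | inj₂ (l , pl) = <⇒≱ smaller (minimum (clearCluster B q) forcing)
  where
    smaller : size (clearCluster B q) < size B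
    smaller = subst (size (clearCluster B q) <_)
                (trans (cong (size (clearCluster B q) +_) (sym (single q))) (size-clearCluster B q))
                (m<m+n (size (clearCluster B q)) (s≤s z≤n))
    forcing : IsForcingSet G _ (clearCluster B q)
    forcing = (clear-forced-step G pi qk pq pl union (confined-by-uniqueness G union unique qk pq) , tt) ∷
                Process-forget rest

ℓOne<n : ∀ {n r} (G : Graph (suc n)) {B : Col (suc n) (suc (suc r))} →
  Process G _ ExactlyOneClusterForced nothing B → HasMinimumSize G _ B → ℓOne B < suc n
ℓOne<n G {B} process minimum = ≤∧≢⇒< (countFin-≤ (isOneCluster B)) λ ℓ≡n →
  all-one-not-minimum G (λ u → isOneCluster⇒single B u (countFin≡m⇒true (isOneCluster B) ℓ≡n u))
    process minimum

aAll-K₁ : ∀ {r} (G : Graph 1) (B : Col 1 r) → IsForcingSet G r B → aAll B ≡ 1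
aAll-K₁ G B (done full) rewrite allFin?-complete (B zero) (full zero) = refl
aAll-K₁ G B ((ordinary (zero , _) (zero , _) _ _ loop _ _ , _) ∷ _) =
  ⊥-elim (≡true⇒≢false loop (irrefl G zero))

digit-<-mono : ∀ {n a a' ℓ ℓ'} → ℓ < n → a < a' → n * a + ℓ < n * a' + ℓ'
digit-<-mono {n} {a} {a'} {ℓ} {ℓ'} ℓ<n a<a' = begin-strict
  n * a + ℓ   <⟨ +-monoʳ-< (n * a) ℓ<n ⟩
  n * a + n   ≡⟨ +-comm (n * a) n ⟩
  n + n * a   ≡⟨ sym (*-suc n a) ⟩
  n * suc a   ≤⟨ *-monoʳ-≤ n a<a' ⟩
  n * a'      ≤⟨ m≤m+n (n * a') ℓ' ⟩
  n * a' + ℓ' ∎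
  where open ≤-Reasoning

leading-digit-unique : ∀ {n r a a' ℓ ℓ'} → n ≤ r → ℓ < n → ℓ' < n →
  n * a' + ℓ' ≤ n * a + ℓ → r * a + ℓ ≤ r * a' + ℓ' → a ≡ a'
leading-digit-unique {a = a} {a'} n≤r ℓ<n ℓ'<n n-bound r-bound with <-cmp a a'
... | tri< a<a' _ _ = contradiction n-bound (<⇒≱ (digit-<-mono ℓ<n a<a'))
... | tri≈ _ a≡a' _ = a≡a'
... | tri> _ _ a>a' = contradiction r-bound (<⇒≱ (digit-<-mono (<-≤-trans ℓ'<n n≤r) a>a'))

proposition2p14 : ∀ {n : ℕ} (G : Graph n) (r : ℕ) → n ≤ r →
    (B : Col n r) → OptimalAON G r B →
    (B⋆ : Col n n) → OptimalAON G n B⋆ →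
    aAll B ≡ aAll B⋆
proposition2p14 {zero} G r _ B _ B⋆ _ = refl
proposition2p14 {suc zero} G r _ B (_ , (forcing , _) , _) B⋆ (_ , (forcing⋆ , _) , _) =
  trans (aAll-K₁ G B forcing) (sym (aAll-K₁ G B⋆ forcing⋆))
proposition2p14 {suc (suc n)} G (suc (suc r)) n≤r@(s≤s (s≤s _))
                B (aon , (_ , minimum) , process) B⋆ (aon⋆ , (_ , minimum⋆) , process⋆) =
  leading-digit-unique n≤r (ℓOne<n G process minimum) (ℓOne<n G process⋆ minimum⋆)
    (canonical-size-bound G {B = B} {B⋆} aon aon⋆ process minimum⋆)
    (canonical-size-bound G {B = B⋆} {B} aon⋆ aon process⋆ minimum)
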